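{- Let $G$ be a connected graph of order $n$ and stability number $\alpha$ such that $F(G)\ge F(H)$ for every connected graph $H$ of order $n$ and stability number $\alpha$. Then either $G$ is $\alpha$-critical, or $G$ has an $\alpha$-critical decomposition.
   Context: Graphs are finite, simple, undirected. $F(G)$ is the number of stable sets of $G$ including the empty set; $\alpha(G)$ is the stability number. An edge $e$ is $\alpha$-critical if $\alpha(G-e)>\alpha(G)$ (where $G-e$ is $G$ with $e$ removed), and $\alpha$-safe otherwise; $G$ is $\alpha$-critical if all its edges are $\alpha$-critical (an edgeless graph is $\alpha$-critical by convention). A bridge of a connected graph $G$ is an edge $e$ such that $G-e$ is disconnected. To an $\alpha$-safe bridge $e=v_1v_2$ is associated a decomposition $(G_1,v_1,G_2,v_2)$, where $G_1,G_2$ are the two connected components of $G-e$ with $v_1\in V(G_1)$, $v_2\in V(G_2)$. A decomposition is $\alpha$-critical if $G_1$ is $\alpha$-critical. -}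

module Defs where

open import Data.Nat using (ℕ; zero; suc; _⊔_; _<_; _≤_)
open import Data.Bool using (Bool; true; false; _∧_; not; _∨_)
open import Data.Bool.Properties using (∨-comm; ∧-comm) renaming (_≟_ to _≟ᵇ_)
open import Data.Fin using (Fin)
open import Data.Fin.Properties using (all?) renaming (_≟_ to _≟ᶠ_)
open import Data.Fin.Subset using (Subset; _∈_; _⊆_; ∣_∣; ⊤; inside; outside)
open import Data.Fin.Subset.Properties using (_∈?_; _⊆?_)
open import Data.Vec using (_∷_; [])
open import Data.List using (List; []; _∷_; _++_; map; filter; length; foldr)
open import Data.Product using (_×_; Σ; ∃; _,_)
open import Data.Sum using (_⊎_)
open import Relation.Nullary using (Dec; ¬_)
open import Relation.Nullary.Decidable using (_×-dec_; _→-dec_; ⌊_⌋)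
open import Relation.Binary.PropositionalEquality using (_≡_; refl; trans; cong₂)
open import Function.Bundles using (_⇔_)

record Graph (n : ℕ) : Set where
  field
    adj    : Fin n → Fin n → Bool
    sym    : ∀ i j → adj i j ≡ adj j i
    irrefl : ∀ i → adj i i ≡ false
open Graph public

Edge : ∀ {n} → Graph n → Fin n → Fin n → Set
Edge G u v = adj G u v ≡ true

sameEdge : ∀ {n} → Fin n → Fin n → Fin n → Fin n → Bool
sameEdge u v i j = (⌊ i ≟ᶠ u ⌋ ∧ ⌊ j ≟ᶠ v ⌋) ∨ (⌊ i ≟ᶠ v ⌋ ∧ ⌊ j ≟ᶠ u ⌋)

sameEdge-sym : ∀ {n} (u v i j : Fin n) → sameEdge u v i j ≡ sameEdge u v j i
sameEdge-sym u v i j =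
  trans (∨-comm (⌊ i ≟ᶠ u ⌋ ∧ ⌊ j ≟ᶠ v ⌋) (⌊ i ≟ᶠ v ⌋ ∧ ⌊ j ≟ᶠ u ⌋))
        (cong₂ _∨_ (∧-comm ⌊ i ≟ᶠ v ⌋ ⌊ j ≟ᶠ u ⌋) (∧-comm ⌊ i ≟ᶠ u ⌋ ⌊ j ≟ᶠ v ⌋))

removeEdge : ∀ {n} → Graph n → Fin n → Fin n → Graph n
removeEdge G u v = record
  { adj    = λ i j → adj G i j ∧ not (sameEdge u v i j)
  ; sym    = λ i j → cong₂ (λ a b → a ∧ not b) (Graph.sym G i j) (sameEdge-sym u v i j)
  ; irrefl = λ i → irr i
  }
  where
  irr : ∀ i → (adj G i i ∧ not (sameEdge u v i i)) ≡ false
  irr i with adj G i i | Graph.irrefl G i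
  ... | .false | refl = refl

data Reach {n} (G : Graph n) : Fin n → Fin n → Set where
  here : ∀ {i} → Reach G i i
  step : ∀ {i j k} → Edge G i j → Reach G j k → Reach G i k

Connected : ∀ {n} → Graph n → Set
Connected G = ∀ i j → Reach G i j

Stable : ∀ {n} → Graph n → Subset n → Set
Stable G S = ∀ i j → i ∈ S → j ∈ S → adj G i j ≡ false

stable? : ∀ {n} (G : Graph n) (S : Subset n) → Dec (Stable G S)
stable? G S = all? λ i → all? λ j → (i ∈? S) →-dec ((j ∈? S) →-dec (adj G i j ≟ᵇ false))

-- all subsets of Fin n (each exactly once)
allSubsets : ∀ n → List (Subset n)
allSubsets zero    = [] ∷ []
allSubsets (suc n) = map (outside ∷_) (allSubsets n) ++ map (inside ∷_) (allSubsets n)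

stableIn? : ∀ {n} (G : Graph n) (C : Subset n) (S : Subset n) → Dec (S ⊆ C × Stable G S)
stableIn? G C S = (S ⊆? C) ×-dec stable? G S

stableSetsIn : ∀ {n} → Graph n → Subset n → List (Subset n)
stableSetsIn {n} G C = filter (stableIn? G C) (allSubsets n)

αIn : ∀ {n} → Graph n → Subset n → ℕ
αIn G C = foldr (λ S m → ∣ S ∣ ⊔ m) 0 (stableSetsIn G C)

α : ∀ {n} → Graph n → ℕ
α G = αIn G ⊤

-- F(G): number of stable sets of G (including the empty set)
F : ∀ {n} → Graph n → ℕ
F {n} G = length (filter (stable? G) (allSubsets n))

-- G[C] is α-critical: every edge uv of G[C] satisfies α(G[C] - uv) > α(G[C])
-- (an edgeless G[C] is vacuously α-critical)
αCriticalIn : ∀ {n} → Graph n → Subset n → Set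
αCriticalIn G C = ∀ u v → u ∈ C → v ∈ C → Edge G u v → αIn G C < αIn (removeEdge G u v) C

αCritical : ∀ {n} → Graph n → Set
αCritical G = αCriticalIn G ⊤

αSafe : ∀ {n} → Graph n → Fin n → Fin n → Set
αSafe G u v = α (removeEdge G u v) ≤ α G

Bridge : ∀ {n} → Graph n → Fin n → Fin n → Set
Bridge G u v = ¬ Connected (removeEdge G u v)

-- G has an α-critical decomposition (G₁, v₁, G₂, v₂): there is an α-safe bridge
-- e = v₁v₂ such that the component G₁ of G - e containing v₁ (the induced
-- subgraph on C₁ = vertices reachable from v₁ in G - e) is α-critical.
HasαCriticalDecomposition : ∀ {n} → Graph n → Set
HasαCriticalDecomposition {n} G =
  Σ (Fin n) λ v₁ → Σ (Fin n) λ v₂ →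
    Edge G v₁ v₂ × Bridge G v₁ v₂ × αSafe G v₁ v₂ ×
    Σ (Subset n) λ C₁ → (∀ x → (x ∈ C₁) ⇔ Reach (removeEdge G v₁ v₂) v₁ x)
                       × αCriticalIn G C₁

module Submission where

-- Deleting an edge strictly increases F, so an α-safe edge e of G
-- must disconnect G (otherwise G - e would beat G): every α-safe edge is a bridge.
--
-- If G is not α-critical, it has an α-safe edge uv, and we look at its side
-- C = vertices reachable from u in G - uv.  If G[C] is α-critical, uv gives the required
-- decomposition.  Otherwise G[C] has an edge ab that is α-safe in G[C]; since C is a union
-- of components of G - uv, ab is then α-safe in G as well, hence a bridge of G, and one of
-- its two sides is strictly contained in C.  Induction on the size of the side ends the
-- descent.

open import Defs
import Level
open import Data.Nat using (ℕ; zero; suc; _⊔_; _<_; _≤_; _+_; _≥_; z≤n; s≤s; s≤s⁻¹; _≤?_)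
open import Data.Nat.Properties as ℕ using ()
open import Data.Bool using (true; false; _∧_; not)
open import Data.Bool.Properties using (∧-zeroʳ; ∧-identityʳ; ∨-comm) renaming (_≟_ to _≟ᵇ_)
open import Data.Fin using (Fin)
open import Data.Fin.Properties using (any?) renaming (_≟_ to _≟ᶠ_)
open import Data.Fin.Subset
  using (Subset; _∈_; _∉_; _⊆_; _⊂_; ∣_∣; ⊤; ⊥; ⁅_⁆; _∪_; _∩_; ∁; inside; outside)
open import Data.Fin.Subset.Properties
  using ( _∈?_; _⊂?_; ∈⊤; ∉⊥; ∣⊥∣≡0; ∣p∣≤n; ∣p∣≡n⇒p≡⊤; p⊂q⇒∣p∣<∣q∣; x∈⁅x⁆; x∈⁅y⁆⇒x≡y
        ; x∈p∪q⁻; x∈p∪q⁺; x∈p∩q⁻; x∈∁p⇒x∉p )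
open import Data.Vec using ([]; _∷_; tabulate; here; there)
open import Data.Vec.Properties using ([]=⇒lookup; lookup⇒[]=; lookup∘tabulate)
open import Data.List using (List; []; _∷_; map; filter; length; foldr)
open import Data.List.Membership.Propositional using () renaming (_∈_ to _∈ˡ_)
open import Data.List.Membership.Propositional.Properties using (∈-map⁺; ∈-++⁺ˡ; ∈-++⁺ʳ; ∈-filter⁺; ∈-filter⁻)
open import Data.List.Relation.Unary.Any using () renaming (here to hereˡ; there to thereˡ)
open import Data.Product using (_×_; ∃; _,_; proj₁; proj₂)
open import Data.Sum using (_⊎_; inj₁; inj₂)
open import Relation.Nullary using (Dec; yes; no; ¬_; contradiction)
open import Relation.Nullary.Decidable using (⌊_⌋; _×-dec_; _⊎-dec_)
open import Relation.Unary using (Pred; Decidable)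
open import Relation.Binary.PropositionalEquality
  using (_≡_; _≢_; refl; trans; cong; subst) renaming (sym to ≡-sym)
open import Function.Bundles using (_⇔_; mk⇔; Equivalence)
open Equivalence using (to; from)

_⊑_ : ∀ {n} → Graph n → Graph n → Set
_⊑_ {n} H G = ∀ (i j : Fin n) → Edge H i j → Edge G i j

⊑-nonadjacent : ∀ {n} {H G : Graph n} → H ⊑ G → ∀ i j → adj G i j ≡ false → adj H i j ≡ false
⊑-nonadjacent {H = H} H⊑G i j nonadj with adj H i j in eq
... | false = refl
... | true  = trans (≡-sym (H⊑G i j eq)) nonadj

module _ {n : ℕ} (G : Graph n) where

  removeEdge-⊑ : ∀ a b → removeEdge G a b ⊑ G
  removeEdge-⊑ a b i j e with adj G i j
  ... | true  = refl
  ... | false = e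

  removeEdge-swap : ∀ a b → removeEdge G a b ⊑ removeEdge G b a
  removeEdge-swap a b i j e =
    trans (cong (λ s → adj G i j ∧ not s) (∨-comm (⌊ i ≟ᶠ b ⌋ ∧ ⌊ j ≟ᶠ a ⌋) (⌊ i ≟ᶠ a ⌋ ∧ ⌊ j ≟ᶠ b ⌋))) e

  removeEdge-away : ∀ a b i j → i ≢ a → j ≢ a → adj (removeEdge G a b) i j ≡ adj G i j
  removeEdge-away a b i j i≢a j≢a with i ≟ᶠ a | j ≟ᶠ a
  ... | yes i≡a | _       = contradiction i≡a i≢a
  ... | no _    | yes j≡a = contradiction j≡a j≢a
  ... | no _    | no _    rewrite ∧-zeroʳ ⌊ i ≟ᶠ b ⌋ = ∧-identityʳ (adj G i j)

  removeEdge-removes : ∀ a b → adj (removeEdge G a b) a b ≡ false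
  removeEdge-removes a b with a ≟ᶠ a | b ≟ᶠ b
  ... | yes _ | yes _ = ∧-zeroʳ (adj G a b)
  ... | no a≢a | _    = contradiction refl a≢a
  ... | yes _ | no b≢b = contradiction refl b≢b

  removeEdge-lost : ∀ a b y z → Edge G y z → ¬ Edge (removeEdge G a b) y z →
                    (y ≡ a × z ≡ b) ⊎ (y ≡ b × z ≡ a)
  removeEdge-lost a b y z e lost with y ≟ᶠ a | z ≟ᶠ b | y ≟ᶠ b | z ≟ᶠ a
  ... | yes p | yes q | _     | _     = inj₁ (p , q)
  ... | _     | _     | yes p | yes q = inj₂ (p , q)
  ... | yes _ | no _  | yes _ | no _  = contradiction (cong (_∧ true) e) lost
  ... | yes _ | no _  | no _  | _     = contradiction (cong (_∧ true) e) lost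
  ... | no _  | _     | yes _ | no _  = contradiction (cong (_∧ true) e) lost
  ... | no _  | _     | no _  | _     = contradiction (cong (_∧ true) e) lost

reach-snoc : ∀ {n} {G : Graph n} {i j k} → Reach G i j → Edge G j k → Reach G i k
reach-snoc here       e′ = step e′ here
reach-snoc (step e r) e′ = step e (reach-snoc r e′)

reach-trans : ∀ {n} {G : Graph n} {i j k} → Reach G i j → Reach G j k → Reach G i k
reach-trans here       r′ = r′
reach-trans (step e r) r′ = step e (reach-trans r r′)

reach-sym : ∀ {n} {G : Graph n} {i j} → Reach G i j → Reach G j i
reach-sym here = here
reach-sym {G = G} (step {i} {j} e r) = reach-snoc (reach-sym r) (trans (Graph.sym G j i) e)

reach-replace : ∀ {n} {G K : Graph n} → (∀ i j → Edge G i j → Reach K i j) →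
                ∀ {i j} → Reach G i j → Reach K i j
reach-replace f here       = here
reach-replace f (step e r) = reach-trans (f _ _ e) (reach-replace f r)

reach-⊑ : ∀ {n} {H G : Graph n} → H ⊑ G → ∀ {i j} → Reach H i j → Reach G i j
reach-⊑ H⊑G = reach-replace (λ i j e → step (H⊑G i j e) here)

reconnect : ∀ {n} (G : Graph n) a b → Connected G → Reach (removeEdge G a b) a b →
            Connected (removeEdge G a b)
reconnect G a b conn a⇝b i j = reach-replace via (conn i j)
  where
  via : ∀ y z → Edge G y z → Reach (removeEdge G a b) y z
  via y z e with adj (removeEdge G a b) y z ≟ᵇ true
  ... | yes kept = step kept here
  ... | no lost with removeEdge-lost G a b y z e lost
  ...   | inj₁ (refl , refl) = a⇝b
  ...   | inj₂ (refl , refl) = reach-sym a⇝b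

reach-avoiding : ∀ {n} {H G : Graph n} → H ⊑ G → ∀ a b {w x} →
                 (∀ {y} → Reach H w y → y ≢ a) → Reach H w x → Reach (removeEdge G a b) w x
reach-avoiding H⊑G a b avoids here = here
reach-avoiding {G = G} H⊑G a b {w} avoids (step {j = j} e r) =
  step (trans (removeEdge-away G a b w j (avoids here) (avoids (step e here))) (H⊑G w j e))
       (reach-avoiding H⊑G a b (λ r′ → avoids (step e r′)) r)

subsetOf : ∀ {n} {P : Fin n → Set} → (∀ x → Dec (P x)) → Subset n
subsetOf P? = tabulate (λ x → ⌊ P? x ⌋)

subsetOf-spec : ∀ {n} {P : Fin n → Set} (P? : ∀ x → Dec (P x)) x → x ∈ subsetOf P? ⇔ P x
subsetOf-spec {P = P} P? x = mk⇔ sound complete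
  where
  membership : x ∈ subsetOf P? → ⌊ P? x ⌋ ≡ true
  membership m = trans (≡-sym (lookup∘tabulate (λ y → ⌊ P? y ⌋) x)) ([]=⇒lookup m)
  sound : x ∈ subsetOf P? → P x
  sound m with P? x | membership m
  ... | yes p | _ = p
  complete : P x → x ∈ subsetOf P?
  complete p with P? x in eq
  ... | yes _  = lookup⇒[]= x _ (trans (lookup∘tabulate (λ y → ⌊ P? y ⌋) x) (cong ⌊_⌋ eq))
  ... | no ¬p = contradiction p ¬p

module Components {n : ℕ} (G : Graph n) where

  Closed : Subset n → Set
  Closed R = ∀ {x y} → x ∈ R → Edge G x y → y ∈ R

  closed-reach : ∀ {R} → Closed R → ∀ {x y} → x ∈ R → Reach G x y → y ∈ R
  closed-reach cl x∈R here       = x∈R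
  closed-reach cl x∈R (step e r) = closed-reach cl (cl x∈R e) r

  grow : Subset n → Subset n
  grow R = subsetOf (λ x → (x ∈? R) ⊎-dec any? (λ y → (y ∈? R) ×-dec (adj G y x ≟ᵇ true)))

  ⊆-grow : ∀ R → R ⊆ grow R
  ⊆-grow R x∈R = from (subsetOf-spec _ _) (inj₁ x∈R)

  stalled⇒closed : ∀ R → ¬ (R ⊂ grow R) → Closed R
  stalled⇒closed R stalled {x} {y} x∈R e with y ∈? R
  ... | yes y∈R = y∈R
  ... | no y∉R  = contradiction ((λ {z} → ⊆-grow R {z}) , y , y∈grow , y∉R) stalled
    where
    y∈grow : y ∈ grow R
    y∈grow = from (subsetOf-spec _ _) (inj₂ (x , x∈R , e))

  grow-reach : ∀ v R → (∀ {x} → x ∈ R → Reach G v x) → ∀ {x} → x ∈ grow R → Reach G v x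
  grow-reach v R reach m with to (subsetOf-spec _ _) m
  ... | inj₁ x∈R           = reach x∈R
  ... | inj₂ (y , y∈R , e) = reach-snoc (reach y∈R) e

  search : ℕ → Subset n → Subset n
  search zero    R = R
  search (suc k) R with R ⊂? grow R
  ... | yes _ = search k (grow R)
  ... | no _  = R

  ⊆-search : ∀ k R → R ⊆ search k R
  ⊆-search zero    R x∈R = x∈R
  ⊆-search (suc k) R x∈R with R ⊂? grow R
  ... | yes _ = ⊆-search k (grow R) (⊆-grow R x∈R)
  ... | no _  = x∈R

  search-reach : ∀ v k R → (∀ {x} → x ∈ R → Reach G v x) → ∀ {x} → x ∈ search k R → Reach G v x
  search-reach v zero    R reach = reach
  search-reach v (suc k) R reach with R ⊂? grow R
  ... | yes _ = search-reach v k (grow R) (grow-reach v R reach)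
  ... | no _  = reach

  -- Each productive round enlarges R, so after n ∸ ∣ R ∣ rounds the search has stalled.
  search-closed : ∀ k R → n ≤ ∣ R ∣ + k → Closed (search k R)
  search-closed zero R n≤∣R∣ {y = y} _ _ =
    subst (y ∈_) (≡-sym (∣p∣≡n⇒p≡⊤ (ℕ.≤-antisym (∣p∣≤n R) n≤∣R∣′))) ∈⊤
    where
    n≤∣R∣′ : n ≤ ∣ R ∣
    n≤∣R∣′ = ℕ.≤-trans n≤∣R∣ (ℕ.≤-reflexive (ℕ.+-identityʳ _))
  search-closed (suc k) R n≤ with R ⊂? grow R
  ... | yes R⊂grow = search-closed k (grow R)
                       (ℕ.≤-trans n≤ (ℕ.≤-trans (ℕ.≤-reflexive (ℕ.+-suc ∣ R ∣ k))
                                                (ℕ.+-monoˡ-≤ k (p⊂q⇒∣p∣<∣q∣ R⊂grow))))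
  ... | no stalled = stalled⇒closed R stalled

  component : Fin n → Subset n
  component v = search n ⁅ v ⁆

  component-spec : ∀ v x → x ∈ component v ⇔ Reach G v x
  component-spec v x = mk⇔
    (search-reach v n ⁅ v ⁆ (λ m → subst (Reach G v) (≡-sym (x∈⁅y⁆⇒x≡y v m)) here))
    (closed-reach (search-closed n ⁅ v ⁆ (ℕ.m≤n+m n _)) (⊆-search n ⁅ v ⁆ (x∈⁅x⁆ v)))

open Components using (Closed; component; component-spec)

allSubsets-complete : ∀ {n} (S : Subset n) → S ∈ˡ allSubsets n
allSubsets-complete []                    = hereˡ refl
allSubsets-complete {suc n} (outside ∷ S) = ∈-++⁺ˡ (∈-map⁺ (outside ∷_) (allSubsets-complete S))
allSubsets-complete {suc n} (inside ∷ S)  =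
  ∈-++⁺ʳ (map (outside ∷_) (allSubsets n)) (∈-map⁺ (inside ∷_) (allSubsets-complete S))

maxCard : ∀ {n} → List (Subset n) → ℕ
maxCard = foldr (λ S m → ∣ S ∣ ⊔ m) 0

maxCard-ub : ∀ {n} {S : Subset n} L → S ∈ˡ L → ∣ S ∣ ≤ maxCard L
maxCard-ub (_ ∷ L) (hereˡ refl) = ℕ.m≤m⊔n _ _
maxCard-ub (_ ∷ L) (thereˡ m)   = ℕ.≤-trans (maxCard-ub L m) (ℕ.m≤n⊔m _ _)

maxCard-attained : ∀ {n} (L : List (Subset n)) → maxCard L ≡ 0 ⊎ ∃ λ S → S ∈ˡ L × ∣ S ∣ ≡ maxCard L
maxCard-attained []      = inj₁ refl
maxCard-attained (T ∷ L) with ℕ.⊔-sel ∣ T ∣ (maxCard L)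
... | inj₁ eq = inj₂ (T , hereˡ refl , ≡-sym eq)
... | inj₂ eq with maxCard-attained L
...   | inj₁ zero-max          = inj₁ (trans eq zero-max)
...   | inj₂ (S , m , ∣S∣≡max) = inj₂ (S , thereˡ m , trans ∣S∣≡max (≡-sym eq))

αIn-ub : ∀ {n} (G : Graph n) C S → S ⊆ C → Stable G S → ∣ S ∣ ≤ αIn G C
αIn-ub G C S S⊆C st =
  maxCard-ub _ (∈-filter⁺ (stableIn? G C) (allSubsets-complete S) ((λ {x} → S⊆C {x}) , st))

αIn-attained : ∀ {n} (G : Graph n) C → ∃ λ S → S ⊆ C × Stable G S × ∣ S ∣ ≡ αIn G C
αIn-attained {n} G C with maxCard-attained (stableSetsIn G C)
... | inj₁ zero-max =
      ⊥ , (λ m → contradiction m ∉⊥) , (λ i j m _ → contradiction m ∉⊥) , trans (∣⊥∣≡0 n) (≡-sym zero-max)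
... | inj₂ (S , m , ∣S∣≡α) with ∈-filter⁻ (stableIn? G C) {xs = allSubsets n} m
...   | _ , (S⊆C , st) = S , S⊆C , st , ∣S∣≡α

stable-⊑ : ∀ {n} {H G : Graph n} → H ⊑ G → ∀ S → Stable G S → Stable H S
stable-⊑ {H = H} {G} H⊑G S st i j i∈S j∈S = ⊑-nonadjacent {H = H} {G} H⊑G i j (st i j i∈S j∈S)

α-antitone : ∀ {n} {H G : Graph n} → H ⊑ G → ∀ C → αIn G C ≤ αIn H C
α-antitone {H = H} {G} H⊑G C with αIn-attained G C
... | S , S⊆C , st , ∣S∣≡α =
      ℕ.≤-trans (ℕ.≤-reflexive (≡-sym ∣S∣≡α)) (αIn-ub H C S S⊆C (stable-⊑ {H = H} {G} H⊑G S st))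

module _ {A : Set} {P Q : Pred A Level.zero} (P? : Decidable P) (Q? : Decidable Q) (P⇒Q : ∀ {x} → P x → Q x) where

  filter-mono : ∀ L → length (filter P? L) ≤ length (filter Q? L)
  filter-mono []      = z≤n
  filter-mono (x ∷ L) with P? x | Q? x
  ... | yes _ | yes _ = s≤s (filter-mono L)
  ... | yes p | no ¬q = contradiction (P⇒Q p) ¬q
  ... | no _  | yes _ = ℕ.m≤n⇒m≤1+n (filter-mono L)
  ... | no _  | no _  = filter-mono L

  filter-strict : ∀ {y} L → y ∈ˡ L → Q y → ¬ P y → length (filter P? L) < length (filter Q? L)
  filter-strict (x ∷ L) (hereˡ refl) qy ¬py with P? x | Q? x
  ... | yes py | _     = contradiction py ¬py
  ... | no _   | yes _ = s≤s (filter-mono L)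
  ... | no _   | no ¬q = contradiction qy ¬q
  filter-strict (x ∷ L) (thereˡ m) qy ¬py with P? x | Q? x
  ... | yes _ | yes _ = s≤s (filter-strict L m qy ¬py)
  ... | yes p | no ¬q = contradiction (P⇒Q p) ¬q
  ... | no _  | yes _ = ℕ.m≤n⇒m≤1+n (filter-strict L m qy ¬py)
  ... | no _  | no _  = filter-strict L m qy ¬py

-- Deleting an edge uv strictly increases F: {u, v} becomes stable.
F-removeEdge : ∀ {n} (G : Graph n) u v → Edge G u v → F G < F (removeEdge G u v)
F-removeEdge {n} G u v uv =
  filter-strict (stable? G) (stable? H) (λ {S} → stable-⊑ {H = H} {G} (removeEdge-⊑ G u v) S)
                (allSubsets n) (allSubsets-complete P) stable-in-H ¬stable-in-G
  where
  H : Graph n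
  H = removeEdge G u v
  P : Subset n
  P = ⁅ u ⁆ ∪ ⁅ v ⁆
  endpoint : ∀ {x} → x ∈ P → x ≡ u ⊎ x ≡ v
  endpoint {x} m with x∈p∪q⁻ ⁅ u ⁆ ⁅ v ⁆ m
  ... | inj₁ m′ = inj₁ (x∈⁅y⁆⇒x≡y u m′)
  ... | inj₂ m′ = inj₂ (x∈⁅y⁆⇒x≡y v m′)
  stable-in-H : Stable H P
  stable-in-H i j i∈P j∈P with endpoint i∈P | endpoint j∈P
  ... | inj₁ refl | inj₁ refl = Graph.irrefl H i
  ... | inj₂ refl | inj₂ refl = Graph.irrefl H i
  ... | inj₁ refl | inj₂ refl = removeEdge-removes G u v
  ... | inj₂ refl | inj₁ refl = trans (Graph.sym H i j) (removeEdge-removes G u v)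
  ¬stable-in-G : ¬ Stable G P
  ¬stable-in-G st with () ← trans (≡-sym uv) (st u v (x∈p∪q⁺ (inj₁ (x∈⁅x⁆ u))) (x∈p∪q⁺ (inj₂ (x∈⁅x⁆ v))))

∣∣-split : ∀ {n} (p q : Subset n) → ∣ p ∣ ≡ ∣ p ∩ q ∣ + ∣ p ∩ ∁ q ∣
∣∣-split []            []            = refl
∣∣-split (inside ∷ p)  (inside ∷ q)  = cong suc (∣∣-split p q)
∣∣-split (inside ∷ p)  (outside ∷ q) = trans (cong suc (∣∣-split p q)) (≡-sym (ℕ.+-suc _ _))
∣∣-split (outside ∷ p) (inside ∷ q)  = ∣∣-split p q
∣∣-split (outside ∷ p) (outside ∷ q) = ∣∣-split p q

∣∪∣-disjoint : ∀ {n} (p q : Subset n) → (∀ {x} → x ∈ p → x ∉ q) → ∣ p ∪ q ∣ ≡ ∣ p ∣ + ∣ q ∣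
∣∪∣-disjoint []            []            _        = refl
∣∪∣-disjoint (inside ∷ p)  (inside ∷ q)  disjoint = contradiction here (disjoint here)
∣∪∣-disjoint (inside ∷ p)  (outside ∷ q) disjoint =
  cong suc (∣∪∣-disjoint p q (λ m m′ → disjoint (there m) (there m′)))
∣∪∣-disjoint (outside ∷ p) (inside ∷ q)  disjoint =
  trans (cong suc (∣∪∣-disjoint p q (λ m m′ → disjoint (there m) (there m′)))) (≡-sym (ℕ.+-suc _ _))
∣∪∣-disjoint (outside ∷ p) (outside ∷ q) disjoint = ∣∪∣-disjoint p q (λ m m′ → disjoint (there m) (there m′))

FMaximal : ∀ {n} → Graph n → Set
FMaximal {n} G = ∀ (H : Graph n) → Connected H → α H ≡ α G → F G ≥ F H

-- In an F-maximal graph every α-safe edge is a bridge, since G - uv would have larger F.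
safe⇒bridge : ∀ {n} (G : Graph n) → FMaximal G → ∀ u v → Edge G u v → αSafe G u v → Bridge G u v
safe⇒bridge G maximal u v uv safe connected =
  ℕ.<⇒≱ (F-removeEdge G u v uv) (maximal (removeEdge G u v) connected same-α)
  where
  same-α : α (removeEdge G u v) ≡ α G
  same-α = ℕ.≤-antisym safe (α-antitone {H = removeEdge G u v} {G} (removeEdge-⊑ G u v) ⊤)

αSafe-swap : ∀ {n} (G : Graph n) u v → αSafe G u v → αSafe G v u
αSafe-swap G u v safe =
  ℕ.≤-trans (α-antitone {H = removeEdge G u v} {removeEdge G v u} (removeEdge-swap G u v) ⊤) safe

-- An edge ab inside C that is
-- α-safe in G[C] is α-safe in G: in a maximum stable set S of G - ab, replace the part
-- inside C by a maximum stable set T of G[C]; the result is stable in K.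
safe-transfer : ∀ {n} {K G : Graph n} → K ⊑ G → α K ≤ α G → ∀ {C} → Closed K C →
                ∀ {a b} → a ∈ C → b ∈ C → αIn (removeEdge G a b) C ≤ αIn G C → αSafe G a b
safe-transfer {n} {K} {G} K⊑G αK≤αG {C} closed {a} {b} a∈C b∈C locally-safe
  with αIn-attained (removeEdge G a b) ⊤ | αIn-attained G C
... | S , _ , S-stable , ∣S∣≡α | T , T⊆C , T-stable , ∣T∣≡αC = begin
    α (removeEdge G a b)       ≡⟨ ≡-sym ∣S∣≡α ⟩
    ∣ S ∣                      ≡⟨ ∣∣-split S C ⟩
    ∣ S ∩ C ∣ + ∣ B ∣          ≤⟨ ℕ.+-monoˡ-≤ ∣ B ∣ (ℕ.≤-trans inside-C locally-safe) ⟩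
    αIn G C + ∣ B ∣            ≡⟨ cong (_+ ∣ B ∣) (≡-sym ∣T∣≡αC) ⟩
    ∣ T ∣ + ∣ B ∣              ≡⟨ ≡-sym (∣∪∣-disjoint T B (λ t b → B-outside b (T⊆C t))) ⟩
    ∣ T ∪ B ∣                  ≤⟨ αIn-ub K ⊤ (T ∪ B) (λ _ → ∈⊤) stable-in-K ⟩
    α K                        ≤⟨ αK≤αG ⟩
    α G                        ∎
  where
  open ℕ.≤-Reasoning
  B : Subset n
  B = S ∩ ∁ C
  inside-C : ∣ S ∩ C ∣ ≤ αIn (removeEdge G a b) C
  inside-C = αIn-ub (removeEdge G a b) C (S ∩ C) (λ m → proj₂ (x∈p∩q⁻ S C m))
               (λ i j i∈ j∈ → S-stable i j (proj₁ (x∈p∩q⁻ S C i∈)) (proj₁ (x∈p∩q⁻ S C j∈)))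
  B-outside : ∀ {x} → x ∈ B → x ∉ C
  B-outside m = x∈∁p⇒x∉p (proj₂ (x∈p∩q⁻ S (∁ C) m))
  B-in-S : ∀ {x} → x ∈ B → x ∈ S
  B-in-S m = proj₁ (x∈p∩q⁻ S (∁ C) m)
  cross : ∀ i j → i ∈ C → j ∉ C → adj K i j ≡ false
  cross i j i∈C j∉C with adj K i j in e
  ... | false = refl
  ... | true  = contradiction (closed i∈C e) j∉C
  -- Outside C the edge ab is irrelevant, so B is stable in G and hence in K.
  B-stable : ∀ i j → i ∈ B → j ∈ B → adj K i j ≡ false
  B-stable i j i∈B j∈B = ⊑-nonadjacent {H = K} {G} K⊑G i j
    (trans (≡-sym (removeEdge-away G a b i j (λ { refl → B-outside i∈B a∈C })
                                             (λ { refl → B-outside j∈B a∈C })))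
           (S-stable i j (B-in-S i∈B) (B-in-S j∈B)))
  stable-in-K : Stable K (T ∪ B)
  stable-in-K i j i∈ j∈ with x∈p∪q⁻ T B i∈ | x∈p∪q⁻ T B j∈
  ... | inj₁ i∈T | inj₁ j∈T = stable-⊑ {H = K} {G} K⊑G T T-stable i j i∈T j∈T
  ... | inj₁ i∈T | inj₂ j∈B = cross i j (T⊆C i∈T) (B-outside j∈B)
  ... | inj₂ i∈B | inj₁ j∈T = trans (Graph.sym K i j) (cross j i (T⊆C j∈T) (B-outside i∈B))
  ... | inj₂ i∈B | inj₂ j∈B = B-stable i j i∈B j∈B

SafeEdgeIn : ∀ {n} → Graph n → Subset n → Set
SafeEdgeIn G C = ∃ λ u → ∃ λ v → u ∈ C × v ∈ C × Edge G u v × αIn (removeEdge G u v) C ≤ αIn G C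

critical-or-safe : ∀ {n} (G : Graph n) C → αCriticalIn G C ⊎ SafeEdgeIn G C
critical-or-safe G C with any? (λ u → any? λ v →
  (u ∈? C) ×-dec (v ∈? C) ×-dec (adj G u v ≟ᵇ true) ×-dec (αIn (removeEdge G u v) C ≤? αIn G C))
... | yes safe-edge = inj₂ safe-edge
... | no none       = inj₁ λ u v u∈C v∈C uv → ℕ.≰⇒> λ safe → none (u , v , u∈C , v∈C , uv , safe)

side : ∀ {n} → Graph n → Fin n → Fin n → Subset n
side G u v = component (removeEdge G u v) u

side-spec : ∀ {n} (G : Graph n) u v x → x ∈ side G u v ⇔ Reach (removeEdge G u v) u x
side-spec G u v = component-spec (removeEdge G u v) u

side-closed : ∀ {n} (G : Graph n) u v → Closed (removeEdge G u v) (side G u v)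
side-closed G u v {x} {y} x∈ e = from (side-spec G u v y) (reach-snoc (to (side-spec G u v x) x∈) e)

-- If H ⊑ G and the vertex w of the side of uv cannot reach u in H, then the component of
-- w in H lies strictly inside that side: its paths avoid u, so they survive in G - uv.
component-⊂-side : ∀ {n} (G H : Graph n) u v → H ⊑ G → ∀ {w} → w ∈ side G u v → ¬ Reach H w u →
                   component H w ⊂ side G u v
component-⊂-side G H u v H⊑G {w} w∈side cut =
  within , u , from (side-spec G u v u) here , λ m → cut (to (component-spec H w u) m)
  where
  within : component H w ⊆ side G u v
  within {x} m = from (side-spec G u v x)
    (reach-trans (to (side-spec G u v w) w∈side)
                 (reach-avoiding H⊑G u v (λ { r refl → cut r }) (to (component-spec H w x) m)))

bridge-separates : ∀ {n} (G : Graph n) → Connected G → ∀ a b → Bridge G a b → ∀ u →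
                   ¬ Reach (removeEdge G a b) a u ⊎ ¬ Reach (removeEdge G b a) b u
bridge-separates G conn a b bridge u
  with u ∈? component (removeEdge G a b) a | u ∈? component (removeEdge G b a) b
... | no u∉ | _     = inj₁ λ r → u∉ (from (component-spec (removeEdge G a b) a u) r)
... | yes _ | no u∉ = inj₂ λ r → u∉ (from (component-spec (removeEdge G b a) b u) r)
... | yes a⇝u | yes b⇝u = contradiction (reconnect G a b conn a⇝b) bridge
  where
  a⇝b : Reach (removeEdge G a b) a b
  a⇝b = reach-trans (to (component-spec (removeEdge G a b) a u) a⇝u)
          (reach-sym (reach-⊑ (removeEdge-swap G b a) (to (component-spec (removeEdge G b a) b u) b⇝u)))

module Descent {n : ℕ} (G : Graph n) (conn : Connected G) (maximal : FMaximal G) where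

  SmallerSafeEdge : Fin n → Fin n → Set
  SmallerSafeEdge u v = ∃ λ x → ∃ λ y → Edge G x y × αSafe G x y × ∣ side G x y ∣ < ∣ side G u v ∣

  shorter-orientation : ∀ u v a b → a ∈ side G u v → b ∈ side G u v → Edge G a b → αSafe G a b →
                        SmallerSafeEdge u v
  shorter-orientation u v a b a∈C b∈C ab ab-safe
    with bridge-separates G conn a b (safe⇒bridge G maximal a b ab ab-safe) u
  ... | inj₁ cut = a , b , ab , ab-safe ,
        p⊂q⇒∣p∣<∣q∣ (component-⊂-side G (removeEdge G a b) u v (removeEdge-⊑ G a b) a∈C cut)
  ... | inj₂ cut = b , a , trans (Graph.sym G b a) ab , αSafe-swap G a b ab-safe ,
        p⊂q⇒∣p∣<∣q∣ (component-⊂-side G (removeEdge G b a) u v (removeEdge-⊑ G b a) b∈C cut)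

  -- If uv is α-safe but G[side of uv] is not α-critical, the inner safe edge is safe in G
  -- (its side is closed in G - uv), which yields a safe edge with a smaller side.
  smaller-safe-edge : ∀ u v → αSafe G u v → SafeEdgeIn G (side G u v) →
                      SmallerSafeEdge u v
  smaller-safe-edge u v safe (a , b , a∈C , b∈C , ab , locally-safe) =
    shorter-orientation u v a b a∈C b∈C ab
      (safe-transfer {K = removeEdge G u v} {G} (removeEdge-⊑ G u v) safe (side-closed G u v)
                     a∈C b∈C locally-safe)

  descend : ∀ k u v → Edge G u v → αSafe G u v → ∣ side G u v ∣ < k → HasαCriticalDecomposition G
  descend (suc k) u v uv safe small with critical-or-safe G (side G u v)
  ... | inj₁ critical =
        u , v , uv , safe⇒bridge G maximal u v uv safe , safe , side G u v , side-spec G u v , critical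
  ... | inj₂ inner with smaller-safe-edge u v safe inner
  ...   | x , y , xy , xy-safe , smaller = descend k x y xy xy-safe (ℕ.<-≤-trans smaller (s≤s⁻¹ small))

lemma7 : (n : ℕ) (G : Graph n) → Connected G →
    (∀ (H : Graph n) → Connected H → α H ≡ α G → F G ≥ F H) →
    αCritical G ⊎ HasαCriticalDecomposition G
lemma7 n G conn maximal with critical-or-safe G ⊤
... | inj₁ critical = inj₁ critical
... | inj₂ (u , v , _ , _ , uv , safe) =
      inj₂ (Descent.descend G conn maximal (suc n) u v uv safe (s≤s (∣p∣≤n (side G u v))))
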